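{- Let $n\geq 2$. Among $1\leq k\leq n$, the quantity $|\mathcal{I}^{(n)}_{p_k}(P_n^*)|$ is maximized when $k=2$ and when $k=n-1$.
   Context: $P_n$ is the path graph with vertices $x_1,\dots,x_n$ and edges $x_jx_{j+1}$ ($1\leq j\leq n-1$), and the pendant graph $P_n^*$ has vertex set $\{x_1,\dots,x_n\}\sqcup\{p_1,\dots,p_n\}$ and edge set $E(P_n)\sqcup\{x_1p_1,\dots,x_np_n\}$. $\mathcal{I}^{(n)}_v(H)$ is the family of independent sets of size $n$ in a graph $H$ containing the vertex $v$. -}

module Defs where

open import Data.Nat using (ℕ; zero; suc; _+_; _≡ᵇ_)
open import Data.Nat.Properties using () renaming (_≟_ to _≟ℕ_)
open import Data.Bool using (Bool; true; false; T; _∨_)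
open import Data.Bool.Properties using (T?)
open import Data.Fin using (Fin; toℕ)
open import Data.Fin.Properties using (all?)
open import Data.Fin.Subset using (Subset; _∈_; ∣_∣)
open import Data.Fin.Subset.Properties using (_∈?_)
open import Data.Vec using ([]; _∷_)
open import Data.List using (List; []; _∷_; map; concatMap; filter; length)
open import Data.Sum using (_⊎_; inj₁; inj₂)
open import Data.Product using (_×_; _,_)
open import Relation.Nullary using (Dec; yes; no; ¬_)
open import Relation.Nullary.Decidable using (_×-dec_; ¬?; _→-dec_)
open import Relation.Binary.PropositionalEquality using (_≡_)

-- Vertices of the pendant graph P_n^* :
--   inj₁ i  is the path vertex   x_{i+1}
--   inj₂ i  is the pendant vertex p_{i+1}      (i : Fin n, 0-based)
PVert : ℕ → Set
PVert n = Fin n ⊎ Fin n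

x : ∀ {n} → Fin n → PVert n
x = inj₁

p : ∀ {n} → Fin n → PVert n
p = inj₂

adj : ∀ {n} → PVert n → PVert n → Bool
adj (inj₁ i) (inj₁ j) = (suc (toℕ i) ≡ᵇ toℕ j) ∨ (suc (toℕ j) ≡ᵇ toℕ i)
adj (inj₁ i) (inj₂ j) = toℕ i ≡ᵇ toℕ j
adj (inj₂ i) (inj₁ j) = toℕ i ≡ᵇ toℕ j
adj (inj₂ i) (inj₂ j) = false

Adj : ∀ {n} → PVert n → PVert n → Set
Adj u v = T (adj u v)

VSet : ℕ → Set
VSet n = Subset n × Subset n

_∈V_ : ∀ {n} → PVert n → VSet n → Set
inj₁ i ∈V (X , P) = i ∈ X
inj₂ i ∈V (X , P) = i ∈ P

size : ∀ {n} → VSet n → ℕ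
size (X , P) = ∣ X ∣ + ∣ P ∣

Independent : ∀ {n} → VSet n → Set
Independent S = ∀ u v → u ∈V S → v ∈V S → ¬ Adj u v

InI : ∀ n → PVert n → VSet n → Set
InI n v S = Independent S × size S ≡ n × v ∈V S

_∈V?_ : ∀ {n} (v : PVert n) (S : VSet n) → Dec (v ∈V S)
inj₁ i ∈V? (X , P) = i ∈? X
inj₂ i ∈V? (X , P) = i ∈? P

allPV? : ∀ {n} {Q : PVert n → Set} → (∀ v → Dec (Q v)) → Dec (∀ v → Q v)
allPV? {Q = Q} Q? with all? (λ i → Q? (inj₁ i)) | all? (λ i → Q? (inj₂ i))
... | yes a | yes b = yes λ { (inj₁ i) → a i ; (inj₂ i) → b i }
... | no ¬a | _ = no λ f → ¬a (λ i → f (inj₁ i))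
... | yes _ | no ¬b = no λ f → ¬b (λ i → f (inj₂ i))

Independent? : ∀ {n} (S : VSet n) → Dec (Independent S)
Independent? S = allPV? λ u → allPV? λ v →
  (u ∈V? S) →-dec ((v ∈V? S) →-dec ¬? (T? (adj u v)))

InI? : ∀ n v (S : VSet n) → Dec (InI n v S)
InI? n v S = Independent? S ×-dec ((size S ≟ℕ n) ×-dec (v ∈V? S))

allSubsets : ∀ n → List (Subset n)
allSubsets zero = [] ∷ []
allSubsets (suc n) = concatMap (λ s → (false ∷ s) ∷ (true ∷ s) ∷ []) (allSubsets n)

allVSets : ∀ n → List (VSet n)
allVSets n = concatMap (λ X → map (λ P → (X , P)) (allSubsets n)) (allSubsets n)

countI : ∀ n → PVert n → ℕ
countI n v = length (filter (InI? n v) (allVSets n))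

-- An independent set of P_n^* of size n meets each of the n disjoint edges x_j p_j exactly
-- once, so it is determined by its path part X, the pendant part being the complement of X.
-- Containing p_k then means that X is an independent set of the path avoiding x_k, and these
-- split into an independent set of P_{k-1} and one of P_{n-k}: the count is
-- F(k+1) F(n-k+2) with F the Fibonacci numbers.  For a + b = n - 1 one has
-- F(a+2) F(b+2) ≤ 2 F(n), with equality at a = 1 (and symmetrically at b = 1).
module Submission where

open import Defs
open import Data.Nat using (ℕ; _≤_; _∸_)
open import Data.Fin using (Fin; toℕ)
open import Data.Product using (_×_)
open import Relation.Binary.PropositionalEquality using (_≡_)

open import Data.Nat using (zero; suc; _+_; _*_; _<_; s≤s; z≤n)
open import Data.Nat.Properties
open import Data.Fin using (zero; suc)
open import Data.Fin.Properties using (toℕ-injective; toℕ<n)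
open import Data.Fin.Subset using (Subset; inside; outside; _∈_; _∉_; ∁; ∣_∣)
open import Data.Fin.Subset.Properties using (_∈?_; x∈p⇒x∉∁p; x∉p⇒x∈∁p; ∣p∣≤n; ∣∁p∣≡n∸∣p∣)
open import Data.Bool using (Bool; true; false; T; not; _∧_; if_then_else_)
open import Data.Bool.Properties as Bool using (T-∨; ∧-zeroʳ; ∧-identityʳ)
open import Data.Vec using (_∷_; []; here; there)
open import Data.Vec.Properties using (≡-dec)
open import Data.List using (List; []; _∷_; filter; length; map; concatMap; _++_)
open import Data.Product using (_,_)
open import Data.Sum using (inj₁; inj₂)
open import Data.Empty using (⊥; ⊥-elim)
open import Function using (_∘_; _⇔_; mk⇔; Equivalence)
open import Relation.Nullary using (Dec; does; ¬?; _×-dec_; map′)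
open import Relation.Nullary.Decidable using (does-⇔; T?)
open import Relation.Unary using (Decidable)
open import Relation.Binary.PropositionalEquality
  using (refl; sym; trans; cong; cong₂; subst; module ≡-Reasoning)

countᵇ : ∀ {a} {A : Set a} → (A → Bool) → List A → ℕ
countᵇ g [] = 0
countᵇ g (a ∷ as) = if g a then suc (countᵇ g as) else countᵇ g as

module _ {a} {A : Set a} where

  length-filter≡countᵇ : ∀ {P : A → Set} (P? : Decidable P) (xs : List A)
    → length (filter P? xs) ≡ countᵇ (does ∘ P?) xs
  length-filter≡countᵇ P? [] = refl
  length-filter≡countᵇ P? (x ∷ xs) with does (P? x)
  ... | true  = cong suc (length-filter≡countᵇ P? xs)
  ... | false = length-filter≡countᵇ P? xs

  countᵇ-cong : ∀ {g h : A → Bool} → (∀ x → g x ≡ h x) → ∀ xs → countᵇ g xs ≡ countᵇ h xs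
  countᵇ-cong g≗h [] = refl
  countᵇ-cong {h = h} g≗h (x ∷ xs) rewrite g≗h x with h x
  ... | true  = cong suc (countᵇ-cong g≗h xs)
  ... | false = countᵇ-cong g≗h xs

  countᵇ-false : ∀ (xs : List A) → countᵇ (λ _ → false) xs ≡ 0
  countᵇ-false [] = refl
  countᵇ-false (x ∷ xs) = countᵇ-false xs

  countᵇ-++ : ∀ (g : A → Bool) xs ys → countᵇ g (xs ++ ys) ≡ countᵇ g xs + countᵇ g ys
  countᵇ-++ g [] ys = refl
  countᵇ-++ g (x ∷ xs) ys with g x
  ... | true  = cong suc (countᵇ-++ g xs ys)
  ... | false = countᵇ-++ g xs ys

  countᵇ-map : ∀ {b} {B : Set b} (g : B → Bool) (f : A → B) xs
    → countᵇ g (map f xs) ≡ countᵇ (g ∘ f) xs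
  countᵇ-map g f [] = refl
  countᵇ-map g f (x ∷ xs) with g (f x)
  ... | true  = cong suc (countᵇ-map g f xs)
  ... | false = countᵇ-map g f xs

countᵇ-allSubsets-suc : ∀ n (g : Subset (suc n) → Bool)
  → countᵇ g (allSubsets (suc n))
    ≡ countᵇ (g ∘ (outside ∷_)) (allSubsets n) + countᵇ (g ∘ (inside ∷_)) (allSubsets n)
countᵇ-allSubsets-suc n g = go (allSubsets n)
  where
  go : ∀ ss → countᵇ g (concatMap (λ s → (outside ∷ s) ∷ (inside ∷ s) ∷ []) ss)
              ≡ countᵇ (g ∘ (outside ∷_)) ss + countᵇ (g ∘ (inside ∷_)) ss
  go [] = refl
  go (s ∷ ss) with g (outside ∷ s) | g (inside ∷ s)
  ... | true  | true  = cong suc (trans (cong suc (go ss)) (sym (+-suc _ _)))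
  ... | true  | false = cong suc (go ss)
  ... | false | true  = trans (cong suc (go ss)) (sym (+-suc _ _))
  ... | false | false = go ss

_≟ₛ_ : ∀ {n} (P Q : Subset n) → Dec (P ≡ Q)
_≟ₛ_ = ≡-dec Bool._≟_

countᵇ-allSubsets-≟ₛ : ∀ n (Q : Subset n) → countᵇ (λ P → does (P ≟ₛ Q)) (allSubsets n) ≡ 1
countᵇ-allSubsets-≟ₛ zero [] = refl
countᵇ-allSubsets-≟ₛ (suc n) (outside ∷ Q) = begin
  countᵇ (λ P → does (P ≟ₛ (outside ∷ Q))) (allSubsets (suc n))
    ≡⟨ countᵇ-allSubsets-suc n _ ⟩
  countᵇ (λ P → does (P ≟ₛ Q)) (allSubsets n) + countᵇ (λ _ → false) (allSubsets n)
    ≡⟨ cong₂ _+_ (countᵇ-allSubsets-≟ₛ n Q) (countᵇ-false (allSubsets n)) ⟩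
  1 ∎
  where open ≡-Reasoning
countᵇ-allSubsets-≟ₛ (suc n) (inside ∷ Q) = begin
  countᵇ (λ P → does (P ≟ₛ (inside ∷ Q))) (allSubsets (suc n))
    ≡⟨ countᵇ-allSubsets-suc n _ ⟩
  countᵇ (λ _ → false) (allSubsets n) + countᵇ (λ P → does (P ≟ₛ Q)) (allSubsets n)
    ≡⟨ cong₂ _+_ (countᵇ-false (allSubsets n)) (countᵇ-allSubsets-≟ₛ n Q) ⟩
  1 ∎
  where open ≡-Reasoning

countᵇ-allVSets-graph : ∀ n (φ : Subset n → Subset n) (g : Subset n → Bool)
  → countᵇ (λ (X , P) → does (P ≟ₛ φ X) ∧ g X) (allVSets n) ≡ countᵇ g (allSubsets n)
countᵇ-allVSets-graph n φ g = go (allSubsets n)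
  where
  onGraph : VSet n → Bool
  onGraph (X , P) = does (P ≟ₛ φ X) ∧ g X

  fibre : ∀ X → countᵇ (λ P → onGraph (X , P)) (allSubsets n) ≡ (if g X then 1 else 0)
  fibre X with g X
  ... | true  = trans (countᵇ-cong (λ P → ∧-identityʳ _) (allSubsets n))
                      (countᵇ-allSubsets-≟ₛ n (φ X))
  ... | false = trans (countᵇ-cong (λ P → ∧-zeroʳ _) (allSubsets n)) (countᵇ-false (allSubsets n))

  row : Subset n → List (VSet n)
  row X = map (X ,_) (allSubsets n)

  go : ∀ Xs → countᵇ onGraph (concatMap row Xs) ≡ countᵇ g Xs
  go [] = refl
  go (X ∷ Xs) = begin
    countᵇ onGraph (row X ++ concatMap row Xs)
      ≡⟨ countᵇ-++ onGraph (row X) (concatMap row Xs) ⟩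
    countᵇ onGraph (row X) + countᵇ onGraph (concatMap row Xs)
      ≡⟨ cong₂ _+_ (trans (countᵇ-map onGraph (X ,_) (allSubsets n)) (fibre X)) (go Xs) ⟩
    (if g X then 1 else 0) + countᵇ g Xs
      ≡⟨ if-+ (g X) ⟩
    countᵇ g (X ∷ Xs) ∎
    where
    open ≡-Reasoning
    if-+ : ∀ b → (if b then 1 else 0) + countᵇ g Xs ≡ (if b then suc (countᵇ g Xs) else countᵇ g Xs)
    if-+ true  = refl
    if-+ false = refl

PathIndependent : ∀ {n} → Subset n → Set
PathIndependent {n} X = ∀ {i j : Fin n} → suc (toℕ i) ≡ toℕ j → i ∈ X → j ∈ X → ⊥

PathIndependent-tail : ∀ {n} {s} {X : Subset n} → PathIndependent (s ∷ X) → PathIndependent X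
PathIndependent-tail h e i∈X j∈X = h (cong suc e) (there i∈X) (there j∈X)

-- c records whether the vertex just before X is occupied, which blocks the first vertex of X.
independentAfterᵇ : ∀ {n} → Bool → Subset n → Bool
independentAfterᵇ c [] = true
independentAfterᵇ c (outside ∷ X) = independentAfterᵇ false X
independentAfterᵇ c (inside ∷ X) = not c ∧ independentAfterᵇ true X

independentᵇ : ∀ {n} → Subset n → Bool
independentᵇ = independentAfterᵇ false

independentAfterᵇ-true⇒false : ∀ {n} (X : Subset n)
  → T (independentAfterᵇ true X) → T (independentᵇ X)
independentAfterᵇ-true⇒false [] t = t
independentAfterᵇ-true⇒false (outside ∷ X) t = t

independentᵇ-sound : ∀ {n} (X : Subset n) → T (independentᵇ X) → PathIndependent X
independentᵇ-sound (_ ∷ _) t {zero} {zero} () _ _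
independentᵇ-sound (_ ∷ _ ∷ _) t {zero} {suc zero} refl here (there here) = t
independentᵇ-sound (_ ∷ _ ∷ _) t {zero} {suc (suc j)} () _ _
independentᵇ-sound (s ∷ X) t {suc i} {suc j} e (there i∈X) (there j∈X) =
  independentᵇ-sound X (tail s t) (suc-injective e) i∈X j∈X
  where
  tail : ∀ s → T (independentᵇ (s ∷ X)) → T (independentᵇ X)
  tail outside t = t
  tail inside t = independentAfterᵇ-true⇒false X t

independentᵇ-complete : ∀ {n} (X : Subset n) → PathIndependent X → T (independentᵇ X)
independentᵇ-complete [] h = _
independentᵇ-complete (outside ∷ X) h = independentᵇ-complete X (PathIndependent-tail h)
independentᵇ-complete (inside ∷ []) h = _
independentᵇ-complete (inside ∷ inside ∷ X) h = h refl here (there here)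
independentᵇ-complete (inside ∷ outside ∷ X) h =
  independentᵇ-complete X (PathIndependent-tail (PathIndependent-tail h))

pathIndependent? : ∀ {n} (X : Subset n) → Dec (PathIndependent X)
pathIndependent? X = map′ (independentᵇ-sound X) (independentᵇ-complete X) (T? (independentᵇ X))

Disjoint : ∀ {n} → Subset n → Subset n → Set
Disjoint X P = ∀ {i} → i ∈ X → i ∈ P → ⊥

Disjoint-tail : ∀ {n} {s t} {X P : Subset n} → Disjoint (s ∷ X) (t ∷ P) → Disjoint X P
Disjoint-tail d i∈X i∈P = d (there i∈X) (there i∈P)

Disjoint⇒∣X∣+∣P∣≤n : ∀ {n} (X P : Subset n) → Disjoint X P → ∣ X ∣ + ∣ P ∣ ≤ n
Disjoint⇒∣X∣+∣P∣≤n [] [] d = z≤n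
Disjoint⇒∣X∣+∣P∣≤n (inside ∷ X) (inside ∷ P) d = ⊥-elim (d here here)
Disjoint⇒∣X∣+∣P∣≤n (inside ∷ X) (outside ∷ P) d = s≤s (Disjoint⇒∣X∣+∣P∣≤n X P (Disjoint-tail d))
Disjoint⇒∣X∣+∣P∣≤n {suc n} (outside ∷ X) (inside ∷ P) d =
  subst (_≤ suc n) (sym (+-suc ∣ X ∣ ∣ P ∣)) (s≤s (Disjoint⇒∣X∣+∣P∣≤n X P (Disjoint-tail d)))
Disjoint⇒∣X∣+∣P∣≤n (outside ∷ X) (outside ∷ P) d =
  m≤n⇒m≤1+n (Disjoint⇒∣X∣+∣P∣≤n X P (Disjoint-tail d))

Disjoint∧∣X∣+∣P∣≡n⇒P≡∁X : ∀ {n} (X P : Subset n) → Disjoint X P → ∣ X ∣ + ∣ P ∣ ≡ n → P ≡ ∁ X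
Disjoint∧∣X∣+∣P∣≡n⇒P≡∁X [] [] d e = refl
Disjoint∧∣X∣+∣P∣≡n⇒P≡∁X (inside ∷ X) (inside ∷ P) d e = ⊥-elim (d here here)
Disjoint∧∣X∣+∣P∣≡n⇒P≡∁X (inside ∷ X) (outside ∷ P) d e =
  cong (outside ∷_) (Disjoint∧∣X∣+∣P∣≡n⇒P≡∁X X P (Disjoint-tail d) (suc-injective e))
Disjoint∧∣X∣+∣P∣≡n⇒P≡∁X (outside ∷ X) (inside ∷ P) d e =
  cong (inside ∷_) (Disjoint∧∣X∣+∣P∣≡n⇒P≡∁X X P (Disjoint-tail d)
    (suc-injective (trans (sym (+-suc ∣ X ∣ ∣ P ∣)) e)))
Disjoint∧∣X∣+∣P∣≡n⇒P≡∁X {suc n} (outside ∷ X) (outside ∷ P) d e =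
  ⊥-elim (1+n≰n (subst (_≤ n) e (Disjoint⇒∣X∣+∣P∣≤n X P (Disjoint-tail d))))

∣X∣+∣∁X∣≡n : ∀ {n} (X : Subset n) → ∣ X ∣ + ∣ ∁ X ∣ ≡ n
∣X∣+∣∁X∣≡n X = trans (cong (∣ X ∣ +_) (∣∁p∣≡n∸∣p∣ X)) (m+[n∸m]≡n (∣p∣≤n X))

InI-pendant⇔ : ∀ n (k : Fin n) (X P : Subset n)
  → InI n (p k) (X , P) ⇔ (P ≡ ∁ X × PathIndependent X × k ∉ X)
InI-pendant⇔ n k X P = mk⇔ to from
  where
  to : InI n (p k) (X , P) → P ≡ ∁ X × PathIndependent X × k ∉ X
  to (independent , size≡n , k∈P) = P≡∁X , path , k∉X
    where
    P≡∁X : P ≡ ∁ X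
    P≡∁X = Disjoint∧∣X∣+∣P∣≡n⇒P≡∁X X P
      (λ {i} i∈X i∈P → independent (x i) (p i) i∈X i∈P (≡⇒≡ᵇ (toℕ i) (toℕ i) refl)) size≡n
    path : PathIndependent X
    path {i} {j} e i∈X j∈X =
      independent (x i) (x j) i∈X j∈X (Equivalence.from T-∨ (inj₁ (≡⇒≡ᵇ _ _ e)))
    k∉X : k ∉ X
    k∉X k∈X = x∈p⇒x∉∁p k∈X (subst (k ∈_) P≡∁X k∈P)

  from : P ≡ ∁ X × PathIndependent X × k ∉ X → InI n (p k) (X , P)
  from (refl , path , k∉X) = independent , ∣X∣+∣∁X∣≡n X , x∉p⇒x∈∁p k∉X
    where
    independent : Independent (X , ∁ X)
    independent (inj₁ i) (inj₁ j) i∈X j∈X a with Equivalence.to T-∨ a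
    ... | inj₁ i→j = path (≡ᵇ⇒≡ _ _ i→j) i∈X j∈X
    ... | inj₂ j→i = path (≡ᵇ⇒≡ _ _ j→i) j∈X i∈X
    independent (inj₁ i) (inj₂ j) i∈X j∈∁X a with toℕ-injective (≡ᵇ⇒≡ (toℕ i) (toℕ j) a)
    ... | refl = x∈p⇒x∉∁p i∈X j∈∁X
    independent (inj₂ i) (inj₁ j) i∈∁X j∈X a with toℕ-injective (≡ᵇ⇒≡ (toℕ i) (toℕ j) a)
    ... | refl = x∈p⇒x∉∁p j∈X i∈∁X
    independent (inj₂ _) (inj₂ _) _ _ ()

fib : ℕ → ℕ
fib 0 = 0
fib 1 = 1
fib (suc (suc n)) = fib (suc n) + fib n

fib-mono : ∀ n → fib n ≤ fib (suc n)
fib-mono zero = z≤n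
fib-mono (suc n) = m≤m+n (fib (suc n)) (fib n)

countᵇ-independent : ∀ m → countᵇ independentᵇ (allSubsets m) ≡ fib (2 + m)
countᵇ-independent 0 = refl
countᵇ-independent 1 = refl
countᵇ-independent (suc (suc m)) = begin
  countᵇ independentᵇ (allSubsets (2 + m))
    ≡⟨ countᵇ-allSubsets-suc (suc m) independentᵇ ⟩
  countᵇ independentᵇ (allSubsets (1 + m)) + countᵇ (independentAfterᵇ true) (allSubsets (1 + m))
    ≡⟨ cong (countᵇ independentᵇ (allSubsets (1 + m)) +_)
            (countᵇ-allSubsets-suc m (independentAfterᵇ true)) ⟩
  countᵇ independentᵇ (allSubsets (1 + m))
    + (countᵇ independentᵇ (allSubsets m) + countᵇ (λ _ → false) (allSubsets m))
    ≡⟨ cong₂ _+_ (countᵇ-independent (suc m))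
                 (trans (cong (countᵇ independentᵇ (allSubsets m) +_) (countᵇ-false (allSubsets m)))
                        (+-identityʳ _)) ⟩
  fib (3 + m) + countᵇ independentᵇ (allSubsets m)
    ≡⟨ cong (fib (3 + m) +_) (countᵇ-independent m) ⟩
  fib (4 + m) ∎
  where open ≡-Reasoning

avoidingAfterᵇ : ∀ {n} → Bool → Fin n → Subset n → Bool
avoidingAfterᵇ c k X = independentAfterᵇ c X ∧ not (does (k ∈? X))

-- X splits at x_k into the toℕ k vertices before it, carrying fib (2 + toℕ k) independent
-- sets (fib (1 + toℕ k) when the first one is blocked, c ≡ true), and the n ∸ suc (toℕ k)
-- vertices after it.
countᵇ-avoidingAfter : ∀ {n} c (k : Fin n)
  → countᵇ (avoidingAfterᵇ c k) (allSubsets n)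
    ≡ fib ((if c then 1 else 2) + toℕ k) * fib (2 + (n ∸ suc (toℕ k)))
countᵇ-avoidingAfter {suc m} c zero = begin
  countᵇ (avoidingAfterᵇ c zero) (allSubsets (suc m))
    ≡⟨ countᵇ-allSubsets-suc m (avoidingAfterᵇ c zero) ⟩
  countᵇ (λ s → independentᵇ s ∧ true) (allSubsets m)
    + countᵇ (λ s → (not c ∧ independentAfterᵇ true s) ∧ false) (allSubsets m)
    ≡⟨ cong₂ _+_ (trans (countᵇ-cong (λ s → ∧-identityʳ _) (allSubsets m)) (countᵇ-independent m))
                 (trans (countᵇ-cong (λ s → ∧-zeroʳ _) (allSubsets m))
                        (countᵇ-false (allSubsets m))) ⟩
  fib (2 + m) + 0
    ≡⟨ first-vertex c ⟩
  fib ((if c then 1 else 2) + 0) * fib (2 + m) ∎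
  where
  open ≡-Reasoning
  first-vertex : ∀ c → fib (2 + m) + 0 ≡ fib ((if c then 1 else 2) + 0) * fib (2 + m)
  first-vertex true  = refl
  first-vertex false = refl
countᵇ-avoidingAfter {suc m} false (suc k) = begin
  countᵇ (avoidingAfterᵇ false (suc k)) (allSubsets (suc m))
    ≡⟨ countᵇ-allSubsets-suc m (avoidingAfterᵇ false (suc k)) ⟩
  countᵇ (avoidingAfterᵇ false k) (allSubsets m) + countᵇ (avoidingAfterᵇ true k) (allSubsets m)
    ≡⟨ cong₂ _+_ (countᵇ-avoidingAfter false k) (countᵇ-avoidingAfter true k) ⟩
  fib (2 + toℕ k) * R + fib (1 + toℕ k) * R
    ≡⟨ sym (*-distribʳ-+ R (fib (2 + toℕ k)) (fib (1 + toℕ k))) ⟩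
  fib (3 + toℕ k) * R ∎
  where
  open ≡-Reasoning
  R = fib (2 + (m ∸ suc (toℕ k)))
countᵇ-avoidingAfter {suc m} true (suc k) = begin
  countᵇ (avoidingAfterᵇ true (suc k)) (allSubsets (suc m))
    ≡⟨ countᵇ-allSubsets-suc m (avoidingAfterᵇ true (suc k)) ⟩
  countᵇ (avoidingAfterᵇ false k) (allSubsets m) + countᵇ (λ _ → false) (allSubsets m)
    ≡⟨ cong₂ _+_ (countᵇ-avoidingAfter false k) (countᵇ-false (allSubsets m)) ⟩
  fib (2 + toℕ k) * fib (2 + (m ∸ suc (toℕ k))) + 0
    ≡⟨ +-identityʳ _ ⟩
  fib (2 + toℕ k) * fib (2 + (m ∸ suc (toℕ k))) ∎
  where open ≡-Reasoning

countI-pendant : ∀ n (k : Fin n)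
  → countI n (p k) ≡ fib (2 + toℕ k) * fib (2 + (n ∸ suc (toℕ k)))
countI-pendant n k = begin
  countI n (p k)
    ≡⟨ length-filter≡countᵇ (InI? n (p k)) (allVSets n) ⟩
  countᵇ (does ∘ InI? n (p k)) (allVSets n)
    ≡⟨ countᵇ-cong (λ (X , P) → does-⇔ (InI-pendant⇔ n k X P) (InI? n (p k) (X , P))
         (P ≟ₛ ∁ X ×-dec (pathIndependent? X ×-dec ¬? (k ∈? X)))) (allVSets n) ⟩
  countᵇ (λ (X , P) → does (P ≟ₛ ∁ X) ∧ avoidingAfterᵇ false k X) (allVSets n)
    ≡⟨ countᵇ-allVSets-graph n ∁ (avoidingAfterᵇ false k) ⟩
  countᵇ (avoidingAfterᵇ false k) (allSubsets n)
    ≡⟨ countᵇ-avoidingAfter false k ⟩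
  fib (2 + toℕ k) * fib (2 + (n ∸ suc (toℕ k))) ∎
  where open ≡-Reasoning

fib-product-≤ : ∀ a b → fib (2 + a) * fib (2 + b) ≤ 2 * fib (1 + a + b)
fib-product-≤ zero b = begin
  fib (2 + b) + 0            ≡⟨ +-identityʳ _ ⟩
  fib (1 + b) + fib b        ≤⟨ +-monoʳ-≤ (fib (1 + b)) (fib-mono b) ⟩
  fib (1 + b) + fib (1 + b)  ≡⟨ cong (fib (1 + b) +_) (sym (+-identityʳ _)) ⟩
  2 * fib (1 + b)            ∎
  where open ≤-Reasoning
fib-product-≤ (suc zero) b = ≤-refl
fib-product-≤ (suc (suc a)) b = begin
  fib (4 + a) * fib (2 + b)
    ≡⟨ *-distribʳ-+ (fib (2 + b)) (fib (3 + a)) (fib (2 + a)) ⟩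
  fib (3 + a) * fib (2 + b) + fib (2 + a) * fib (2 + b)
    ≤⟨ +-mono-≤ (fib-product-≤ (suc a) b) (fib-product-≤ a b) ⟩
  2 * fib (2 + a + b) + 2 * fib (1 + a + b)
    ≡⟨ sym (*-distribˡ-+ 2 (fib (2 + a + b)) (fib (1 + a + b))) ⟩
  2 * fib (3 + a + b) ∎
  where open ≤-Reasoning

countI-pendant-≤ : ∀ n (k : Fin n) → countI n (p k) ≤ 2 * fib n
countI-pendant-≤ n k = begin
  countI n (p k)
    ≡⟨ countI-pendant n k ⟩
  fib (2 + toℕ k) * fib (2 + (n ∸ suc (toℕ k)))
    ≤⟨ fib-product-≤ (toℕ k) _ ⟩
  2 * fib (suc (toℕ k) + (n ∸ suc (toℕ k)))
    ≡⟨ cong (λ m → 2 * fib m) (m+[n∸m]≡n (toℕ<n k)) ⟩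
  2 * fib n ∎
  where open ≤-Reasoning

countI-pendant-second : ∀ n (k : Fin n) → toℕ k ≡ 1 → countI n (p k) ≡ 2 * fib n
countI-pendant-second n k k≡1 = begin
  countI n (p k)
    ≡⟨ countI-pendant n k ⟩
  fib (2 + toℕ k) * fib (2 + (n ∸ suc (toℕ k)))
    ≡⟨ cong (λ i → fib (2 + i) * fib (2 + (n ∸ suc i))) k≡1 ⟩
  2 * fib (2 + (n ∸ 2))
    ≡⟨ cong (λ m → 2 * fib m) (m+[n∸m]≡n 2≤n) ⟩
  2 * fib n ∎
  where
  open ≡-Reasoning
  2≤n : 2 ≤ n
  2≤n = subst (_< n) k≡1 (toℕ<n k)

countI-pendant-penultimate : ∀ n (k : Fin n) → 2 ≤ n → toℕ k ≡ n ∸ 2 → countI n (p k) ≡ 2 * fib n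
countI-pendant-penultimate (suc (suc m)) k (s≤s (s≤s _)) k≡m = begin
  countI (2 + m) (p k)
    ≡⟨ countI-pendant (2 + m) k ⟩
  fib (2 + toℕ k) * fib (2 + (2 + m ∸ suc (toℕ k)))
    ≡⟨ cong (λ i → fib (2 + i) * fib (2 + (2 + m ∸ suc i))) k≡m ⟩
  fib (2 + m) * fib (2 + (1 + m ∸ m))
    ≡⟨ cong (λ i → fib (2 + m) * fib (2 + i)) (m+n∸n≡m 1 m) ⟩
  fib (2 + m) * 2
    ≡⟨ *-comm (fib (2 + m)) 2 ⟩
  2 * fib (2 + m) ∎
  where open ≡-Reasoning

corollary1 : (n : ℕ) → 2 ≤ n → (k two nm1 : Fin n)
    → toℕ two ≡ 1 → toℕ nm1 ≡ n ∸ 2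
    → countI n (p k) ≤ countI n (p two) × countI n (p k) ≤ countI n (p nm1)
corollary1 n 2≤n k two nm1 two≡1 nm1≡n∸2 =
  ≤-trans (countI-pendant-≤ n k) (≤-reflexive (sym (countI-pendant-second n two two≡1))) ,
  ≤-trans (countI-pendant-≤ n k) (≤-reflexive (sym (countI-pendant-penultimate n nm1 2≤n nm1≡n∸2)))
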